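{- For the barrier coverage problem, there is a family of instances (all with the same ratio $\rho=\max_i r_i/\min_i r_i$) along which the ratio of the minimum cost of an order-preserving solution to the minimum cost of an arbitrary solution tends to $\rho$.
   Context: An instance consists of sensors with positions $x_1\le\cdots\le x_n$ and radii $r_i>0$ and a barrier $[0,L]$. A solution is $y\in\mathbb{R}^n$ with $[0,L]\subseteq\bigcup_i [y_i-r_i,y_i+r_i]$, of cost $\sum_i|y_i-x_i|$. A subset $S$ is active for $y$ if the intervals $[y_i-r_i,y_i+r_i]$, $i\in S$, alone cover $[0,L]$. A solution $y$ is order-preserving if it has an active set $S$ such that $y_i<y_j$ for all $i<j$ in $S$.
   Formalization: The ratio ρ ranges over the rationals at least 1, and the instances' positions, radii and barrier length $L$ are rational, with solutions $y$ taken in ℚ^n. -}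

module Defs where

open import Data.Nat using (ℕ; zero; suc)
open import Data.Fin using (Fin; zero; suc) renaming (_<_ to _<ᶠ_)
open import Data.Fin.Subset using (Subset; _∈_)
open import Data.Rational using (ℚ; _≤_; _<_; _+_; _*_; _-_; ∣_∣; _⊔_; _⊓_; 0ℚ; 1ℚ)
open import Data.Product using (Σ; ∃; ∃-syntax; _×_)
open import Relation.Binary.PropositionalEquality using (_≡_)

sumFin : (n : ℕ) → (Fin n → ℚ) → ℚ
sumFin zero    f = 0ℚ
sumFin (suc n) f = f zero + sumFin n (λ i → f (suc i))

maxFin : (n : ℕ) → (Fin (suc n) → ℚ) → ℚ
maxFin zero    f = f zero
maxFin (suc n) f = f zero ⊔ maxFin n (λ i → f (suc i))

minFin : (n : ℕ) → (Fin (suc n) → ℚ) → ℚ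
minFin zero    f = f zero
minFin (suc n) f = f zero ⊓ minFin n (λ i → f (suc i))

-- An instance: n ≥ 1 sensors (indexed by Fin (suc m), n = suc m),
-- sorted positions x, positive radii r, barrier [0,L].
record Instance : Set where
  field
    m     : ℕ
    x     : Fin (suc m) → ℚ
    r     : Fin (suc m) → ℚ
    L     : ℚ
    x-sorted : ∀ (i j : Fin (suc m)) → i <ᶠ j → x i ≤ x j
    r-pos    : ∀ (i : Fin (suc m)) → 0ℚ < r i

open Instance public

Pos : Instance → Set
Pos I = Fin (suc (m I)) → ℚ

Covers : (I : Instance) → Subset (suc (m I)) → Pos I → Set
Covers I S y = ∀ (p : ℚ) → 0ℚ ≤ p → p ≤ L I →
  ∃[ i ] (i ∈ S × (y i - r I i ≤ p × p ≤ y i + r I i))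

IsSolution : (I : Instance) → Pos I → Set
IsSolution I y = ∀ (p : ℚ) → 0ℚ ≤ p → p ≤ L I →
  ∃[ i ] (y i - r I i ≤ p × p ≤ y i + r I i)

Active : (I : Instance) → Subset (suc (m I)) → Pos I → Set
Active I S y = Covers I S y

OrderPreserving : (I : Instance) → Pos I → Set
OrderPreserving I y = ∃[ S ] (Active I S y ×
  (∀ (i j : Fin (suc (m I))) → i ∈ S → j ∈ S → i <ᶠ j → y i < y j))

cost : (I : Instance) → Pos I → ℚ
cost I y = sumFin (suc (m I)) (λ i → ∣ y i - x I i ∣)

IsMinCost : (I : Instance) → (Pos I → Set) → ℚ → Set
IsMinCost I P c =
  (∀ (y : Pos I) → P y → c ≤ cost I y) ×
  (∀ (ε : ℚ) → 0ℚ < ε → ∃[ y ] (P y × cost I y < c + ε))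

OPT : Instance → ℚ → Set
OPT I c = IsMinCost I (IsSolution I) c

OPTop : Instance → ℚ → Set
OPTop I c = IsMinCost I (λ y → IsSolution I y × OrderPreserving I y) c

-- ρ = max_i r_i / min_i r_i, stated without division.
maxR minR : Instance → ℚ
maxR I = maxFin (m I) (r I)
minR I = minFin (m I) (r I)

HasRatio : Instance → ℚ → Set
HasRatio I ρ = maxR I ≡ ρ * minR I

module Submission where

-- For ρ ≥ 1 and n ≥ 1 take one sensor of radius ρ at -ρ and n unit sensors at 1, 3, …, 2n - 1,
-- with barrier [0 , 2(ρ + n)].  The intervals have total length exactly the barrier length, so
-- every solution tiles the barrier.  A tiling of [u , u + 2H] by intervals with radii rᵢ and
-- centres cᵢ (H = ∑ rᵢ) has first moment ∑ rᵢ cᵢ = H (u + H); hence the displacement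
-- ∑ yᵢ - ∑ xᵢ, a lower bound for the cost, depends only on the position y₀ of the big sensor.
-- It is smallest for y₀ = ρ + 2n (cost 2ρ + 2n), while order preservation forces the big sensor
-- to cover the origin, y₀ = ρ (cost 2ρ (n + 1)).  So optop - ρ·opt is the constant -2ρ(ρ - 1)
-- while opt grows linearly, and optop / opt → ρ.

open import Defs
open import Data.Nat using (ℕ; zero; suc) renaming (_≥_ to _≥ℕ_)
import Data.Nat as ℕ
import Data.Nat.Properties as ℕ
import Data.Integer as ℤ
import Data.Integer.Properties as ℤ
open import Data.Rational.Unnormalised using (mkℚᵘ; *≡*; *<*) renaming (_≃_ to _≃ᵘ_)
import Data.Rational.Unnormalised.Properties as ℚᵘ
open import Data.Rational using (ℚ; mkℚ; _≤_; _<_; _*_; _-_; ∣_∣; 0ℚ; 1ℚ; _+_; -_; _⊔_; _⊓_; 1/_; toℚᵘ; NonZero; positive; nonNegative)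
open import Data.Rational.Properties
open import Data.Product using (Σ; ∃-syntax; _×_; _,_; proj₁; proj₂)
open import Data.Sum using (_⊎_; inj₁; inj₂)
open import Data.Empty using (⊥-elim)
open import Data.Fin using (Fin; zero; suc)
import Data.Fin as Fin
open import Data.Fin.Subset using (⊤)
open import Data.Fin.Subset.Properties using (_∈?_; ∈⊤)
open import Function using (_∘_)
open import Data.List using (List; []; _∷_; _++_; length; tabulate)
open import Data.List.Properties using (length-++-sucʳ; length-tabulate)
open import Data.List.Relation.Unary.Any using (Any; here; there)
open import Data.List.Relation.Unary.Any.Properties using (++⁺ˡ; ++⁺ʳ; ++⁻)
import Data.List.Relation.Unary.Any.Properties as Anyₚ
open import Data.List.Relation.Unary.All using (All; []; _∷_)
import Data.List.Relation.Unary.All as All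
import Data.List.Relation.Unary.All.Properties as Allₚ
open import Data.List.Membership.Propositional using (find)
open import Data.List.Membership.Propositional.Properties using (∈-∃++)
open import Relation.Nullary using (¬_; Dec; yes; no)
open import Relation.Nullary.Decidable using (dec⇒maybe; _×-dec_)
open import Relation.Binary.PropositionalEquality using (_≡_; refl; sym; trans; cong; cong₂; subst; subst₂; module ≡-Reasoning)
open import Level using (0ℓ)
open import Tactic.RingSolver using (solve-∀)
open import Tactic.RingSolver.Core.AlmostCommutativeRing using (AlmostCommutativeRing; fromCommutativeRing)

ℚ-ring : AlmostCommutativeRing 0ℓ 0ℓ
ℚ-ring = fromCommutativeRing +-*-commutativeRing (λ x → dec⇒maybe (0ℚ ≟ x))

+-swapˡ : ∀ a b c → a + (b + c) ≡ b + (a + c)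
+-swapˡ = solve-∀ ℚ-ring

+-right-comm : ∀ a b c → (a + b) + c ≡ (a + c) + b
+-right-comm = solve-∀ ℚ-ring

plus-minus : ∀ a b → (a + b) - b ≡ a
plus-minus = solve-∀ ℚ-ring

minus-plus : ∀ a b → (a - b) + b ≡ a
minus-plus = solve-∀ ℚ-ring

plus-minus-left : ∀ a b → (a + b) - a ≡ b
plus-minus-left = solve-∀ ℚ-ring

<⇒≱ : ∀ {a b} → a < b → ¬ b ≤ a
<⇒≱ a<b b≤a = <-irrefl refl (<-≤-trans a<b b≤a)

≤-by-gap : ∀ {a b} d → 0ℚ ≤ d → a + d ≡ b → a ≤ b
≤-by-gap {a} d 0≤d refl = subst (_≤ a + d) (+-identityʳ a) (+-monoʳ-≤ a 0≤d)

<-by-gap : ∀ {a b} d → 0ℚ < d → a + d ≡ b → a < b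
<-by-gap {a} d 0<d refl = subst (_< a + d) (+-identityʳ a) (+-monoʳ-< a 0<d)

0≤+ : ∀ {a b} → 0ℚ ≤ a → 0ℚ ≤ b → 0ℚ ≤ a + b
0≤+ {a} {b} 0≤a 0≤b = ≤-trans 0≤a (≤-by-gap b 0≤b refl)

0≤* : ∀ {a b} → 0ℚ ≤ a → 0ℚ ≤ b → 0ℚ ≤ a * b
0≤* {a} 0≤a 0≤b = ≤-trans (≤-reflexive (sym (*-zeroʳ a))) (*-monoˡ-≤-nonNeg a {{nonNegative 0≤a}} 0≤b)

0≤1 : 0ℚ ≤ 1ℚ
0≤1 = <⇒≤ (positive⁻¹ 1ℚ)

0≤-diff : ∀ {a b} → a ≤ b → 0ℚ ≤ b - a
0≤-diff {a} a≤b = ≤-trans (≤-reflexive (sym (+-inverseʳ a))) (+-monoˡ-≤ (- a) a≤b)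

diff≤0⇒≤ : ∀ {a b} → a - b ≤ 0ℚ → a ≤ b
diff≤0⇒≤ {a} {b} a-b≤0 = subst₂ _≤_ (minus-plus a b) (+-identityˡ b) (+-monoˡ-≤ b a-b≤0)

0≤diff⇒≤ : ∀ {a b} → 0ℚ ≤ a - b → b ≤ a
0≤diff⇒≤ {a} {b} 0≤a-b =
  ≤-trans (≤-reflexive (sym (+-identityˡ b))) (≤-trans (+-monoˡ-≤ b 0≤a-b) (≤-reflexive (minus-plus a b)))

+-cancelʳ-≤ : ∀ a b c → a + c ≤ b + c → a ≤ b
+-cancelʳ-≤ a b c a+c≤b+c =
  subst₂ _≤_ (plus-minus a c) (plus-minus b c) (+-monoˡ-≤ (- c) a+c≤b+c)

Interval : Set
Interval = ℚ × ℚ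

centre radius : Interval → ℚ
centre = proj₁
radius = proj₂

_∈ᵢ_ : ℚ → Interval → Set
p ∈ᵢ (c , r) = c - r ≤ p × p ≤ c + r

∑ : (Interval → ℚ) → List Interval → ℚ
∑ f []      = 0ℚ
∑ f (e ∷ ℓ) = f e + ∑ f ℓ

rad : List Interval → ℚ
rad = ∑ radius

moment : List Interval → ℚ
moment = ∑ (λ e → radius e * centre e)

CoversOC : List Interval → ℚ → ℚ → Set
CoversOC ℓ a b = ∀ p → a < p → p ≤ b → Any (p ∈ᵢ_) ℓ

pick : ∀ {P : Interval → Set} {ℓ} → Any P ℓ →
  ∃[ as ] ∃[ bs ] ∃[ e ] (ℓ ≡ as ++ e ∷ bs × P e)
pick a with e , e∈ℓ , pe ← find a with as , bs , refl ← ∈-∃++ e∈ℓ = as , bs , e , refl , pe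

any-remove : ∀ {P : Interval → Set} as {e} bs → Any P (as ++ e ∷ bs) → P e ⊎ Any P (as ++ bs)
any-remove as bs a with ++⁻ as a
... | inj₁ in-as          = inj₂ (++⁺ˡ in-as)
... | inj₂ (here pe)      = inj₁ pe
... | inj₂ (there in-bs)  = inj₂ (++⁺ʳ as in-bs)

all-remove : ∀ {P : Interval → Set} as {e} bs → All P (as ++ e ∷ bs) → P e × All P (as ++ bs)
all-remove as bs ps with ps-as , (pe ∷ ps-bs) ← Allₚ.++⁻ as ps = pe , Allₚ.++⁺ ps-as ps-bs

∑-remove : ∀ f as e bs → ∑ f (as ++ e ∷ bs) ≡ f e + ∑ f (as ++ bs)
∑-remove f []       e bs = refl
∑-remove f (a ∷ as) e bs = trans (cong (f a +_) (∑-remove f as e bs)) (+-swapˡ (f a) (f e) (∑ f (as ++ bs)))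

left-of-∉ : ∀ {p} e → p < centre e - radius e → ¬ p ∈ᵢ e
left-of-∉ e p<l (l≤p , _) = <⇒≱ p<l l≤p

right-of-∉ : ∀ {p} e → centre e + radius e < p → ¬ p ∈ᵢ e
right-of-∉ e h<p (_ , p≤h) = <⇒≱ h<p p≤h

_∈ᵢ?_ : ∀ p e → Dec (p ∈ᵢ e)
p ∈ᵢ? (c , r) = (c - r ≤? p) ×-dec (p ≤? c + r)

gap-right : ∀ {a b} e → ¬ a ∈ᵢ e → a < b →
  ∃[ b' ] (a < b' × b' ≤ b × (∀ p → a < p → p ≤ b' → ¬ p ∈ᵢ e))
gap-right {a} {b} e a∉e a<b with centre e - radius e ≤? a
... | yes l≤a = b , a<b , ≤-refl , λ p a<p _ → right-of-∉ e (<-≤-trans (≰⇒> λ a≤h → a∉e (l≤a , a≤h)) (<⇒≤ a<p))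
... | no  l≰a with w , a<w , w<l ← <-dense (≰⇒> l≰a) with w ≤? b
...   | yes w≤b = w , a<w , w≤b , λ p _ p≤w → left-of-∉ e (≤-<-trans p≤w w<l)
...   | no  w≰b = b , a<b , ≤-refl , λ p _ p≤b → left-of-∉ e (≤-<-trans p≤b (<-trans (≰⇒> w≰b) w<l))

closure : ∀ ℓ {a b} → a < b → CoversOC ℓ a b → Any (a ∈ᵢ_) ℓ
closure []      a<b cov with () ← cov _ a<b ≤-refl
closure (e ∷ ℓ) {a} {b} a<b cov with a ∈ᵢ? e
... | yes a∈e = here a∈e
... | no  a∉e with b' , a<b' , b'≤b , e-misses ← gap-right e a∉e a<b =
  there (closure ℓ a<b' λ p a<p p≤b' → drop (cov p a<p (≤-trans p≤b' b'≤b)) (e-misses p a<p p≤b'))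
  where
  drop : ∀ {p} → Any (p ∈ᵢ_) (e ∷ ℓ) → ¬ p ∈ᵢ e → Any (p ∈ᵢ_) ℓ
  drop (here p∈e) p∉e = ⊥-elim (p∉e p∈e)
  drop (there a)  _   = a

NonNegRadii PosRadii : List Interval → Set
NonNegRadii = All (λ e → 0ℚ ≤ radius e)
PosRadii    = All (λ e → 0ℚ < radius e)

rad-nonneg : ∀ {ℓ} → NonNegRadii ℓ → 0ℚ ≤ rad ℓ
rad-nonneg []           = ≤-refl
rad-nonneg (0≤r ∷ 0≤rs) = 0≤+ 0≤r (rad-nonneg 0≤rs)

rad-pos : ∀ {k ℓ} → length ℓ ≡ suc k → PosRadii ℓ → 0ℚ < rad ℓ
rad-pos {ℓ = _ ∷ ℓ} _ (0<r ∷ 0<rs) = <-≤-trans 0<r (≤-by-gap (rad ℓ) (rad-nonneg (All.map <⇒≤ 0<rs)) refl)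

rightEnd : ℚ → List Interval → ℚ
rightEnd u ℓ = u + (rad ℓ + rad ℓ)

≤-rightEnd : ∀ {u ℓ} → NonNegRadii ℓ → u ≤ rightEnd u ℓ
≤-rightEnd 0≤rs = ≤-by-gap _ (0≤+ (rad-nonneg 0≤rs) (rad-nonneg 0≤rs)) refl

rightEnd-shift : ∀ u ℓ d → rightEnd u ℓ + d ≡ rightEnd (u + d) ℓ
rightEnd-shift u ℓ d = shift u (rad ℓ) d
  where
  shift : ∀ u H d → (u + (H + H)) + d ≡ (u + d) + (H + H)
  shift = solve-∀ ℚ-ring

rightEnd-remove : ∀ u as e bs → rightEnd u (as ++ e ∷ bs) ≡ rightEnd u (as ++ bs) + (radius e + radius e)
rightEnd-remove u as e bs =
  trans (cong (λ H → u + (H + H)) (∑-remove radius as e bs)) (regroup u (radius e) (rad (as ++ bs)))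
  where
  regroup : ∀ u r H → u + ((r + H) + (r + H)) ≡ (u + (H + H)) + (r + r)
  regroup = solve-∀ ℚ-ring

cover-left-of : ∀ as e bs {u v w} → CoversOC (as ++ e ∷ bs) u v →
  w ≤ v → w < centre e - radius e → CoversOC (as ++ bs) u w
cover-left-of as e bs cov w≤v w<l p u<p p≤w with any-remove as bs (cov p u<p (≤-trans p≤w w≤v))
... | inj₁ p∈e    = ⊥-elim (left-of-∉ e (≤-<-trans p≤w w<l) p∈e)
... | inj₂ p∈rest = p∈rest

cover-right-of : ∀ as e bs {u v} → CoversOC (as ++ e ∷ bs) u v →
  u ≤ centre e + radius e → CoversOC (as ++ bs) (centre e + radius e) v
cover-right-of as e bs cov u≤h p h<p p≤v with any-remove as bs (cov p (≤-<-trans u≤h h<p) p≤v)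
... | inj₁ p∈e    = ⊥-elim (right-of-∉ e h<p p∈e)
... | inj₂ p∈rest = p∈rest

length-remove : ∀ {k} as (e : Interval) bs → length (as ++ e ∷ bs) ≡ suc k → length (as ++ bs) ≡ k
length-remove as e bs len = ℕ.suc-injective (trans (sym (length-++-sucʳ as e bs)) len)

packing : ∀ k ℓ → length ℓ ≡ k → NonNegRadii ℓ → ∀ {u v} → CoversOC ℓ u v → v ≤ rightEnd u ℓ
packing zero [] _ _ {u} {v} cov with v ≤? u
... | yes v≤u = ≤-trans v≤u (≤-rightEnd [])
... | no  v≰u with () ← cov v (≰⇒> v≰u) ≤-refl
packing (suc k) ℓ len 0≤rs {u} {v} cov with v ≤? u
... | yes v≤u = ≤-trans v≤u (≤-rightEnd 0≤rs)
... | no  v≰u with as , bs , e , refl , (l≤v , v≤h) ← pick (cov v (≰⇒> v≰u) ≤-refl) = begin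
  v                                                ≤⟨ v≤h ⟩
  centre e + radius e                              ≡⟨ left-end-plus-length (centre e) (radius e) ⟩
  (centre e - radius e) + (radius e + radius e)    ≤⟨ +-monoˡ-≤ _ left-end-bound ⟩
  rightEnd u (as ++ bs) + (radius e + radius e)    ≡⟨ sym (rightEnd-remove u as e bs) ⟩
  rightEnd u (as ++ e ∷ bs)                        ∎
  where
  open ≤-Reasoning
  left-end-plus-length : ∀ c r → c + r ≡ (c - r) + (r + r)
  left-end-plus-length = solve-∀ ℚ-ring
  -- The rest must already reach the left end of e, or a gap would remain before e.
  left-end-bound : centre e - radius e ≤ rightEnd u (as ++ bs)
  left-end-bound with centre e - radius e ≤? rightEnd u (as ++ bs)
  ... | yes l≤end = l≤end
  ... | no  l≰end with w , end<w , w<l ← <-dense (≰⇒> l≰end) =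
    ⊥-elim (<⇒≱ end<w (packing k (as ++ bs) (length-remove as e bs len) (proj₂ (all-remove as bs 0≤rs))
                           (cover-left-of as e bs cov (≤-trans (<⇒≤ w<l) l≤v) w<l)))

first-tile : ∀ k as e bs {u} → length (as ++ bs) ≡ k → NonNegRadii (as ++ bs) →
  CoversOC (as ++ e ∷ bs) u (rightEnd u (as ++ e ∷ bs)) → u ∈ᵢ e →
  centre e ≡ u + radius e ×
  CoversOC (as ++ bs) (u + (radius e + radius e)) (rightEnd (u + (radius e + radius e)) (as ++ bs))
first-tile k as (c , r) bs {u} len 0≤rs cov (l≤u , u≤h) =
  c≡u+r , subst₂ (CoversOC rest) right-end-of-e end-of-rest rest-cov
  where
  rest : List Interval
  rest = as ++ bs
  rest-cov : CoversOC rest (c + r) (rightEnd u (as ++ (c , r) ∷ bs))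
  rest-cov = cover-right-of as (c , r) bs cov u≤h
  end-of-rest : rightEnd u (as ++ (c , r) ∷ bs) ≡ rightEnd (u + (r + r)) rest
  end-of-rest = trans (rightEnd-remove u as (c , r) bs) (rightEnd-shift u rest (r + r))
  -- The rest can only reach as far as c + r + 2H', which forces u + r ≤ c.
  u+r≤c : u + r ≤ c
  u+r≤c = +-cancelʳ-≤ (u + r) c (r + (rad rest + rad rest)) (begin
    (u + r) + (r + (rad rest + rad rest))   ≡⟨ regroup u r (rad rest) ⟩
    rightEnd (u + (r + r)) rest            ≡⟨ sym end-of-rest ⟩
    rightEnd u (as ++ (c , r) ∷ bs)        ≤⟨ packing k rest len 0≤rs rest-cov ⟩
    rightEnd (c + r) rest                  ≡⟨ +-assoc c r _ ⟩
    c + (r + (rad rest + rad rest))        ∎)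
    where
    open ≤-Reasoning
    regroup : ∀ u r H → (u + r) + (r + (H + H)) ≡ (u + (r + r)) + (H + H)
    regroup = solve-∀ ℚ-ring
  c≤u+r : c ≤ u + r
  c≤u+r = subst (_≤ u + r) (minus-plus c r) (+-monoˡ-≤ r l≤u)
  c≡u+r : c ≡ u + r
  c≡u+r = ≤-antisym c≤u+r u+r≤c
  right-end-of-e : c + r ≡ u + (r + r)
  right-end-of-e = trans (cong (_+ r) c≡u+r) (+-assoc u r r)

record Within (a b : ℚ) (e : Interval) : Set where
  constructor within
  field
    left-end  : a ≤ centre e - radius e
    right-end : centre e + radius e ≤ b

all-insert : ∀ {P : Interval → Set} as {e} bs → P e → All P (as ++ bs) → All P (as ++ e ∷ bs)
all-insert as bs pe ps with ps-as , ps-bs ← Allₚ.++⁻ as ps = Allₚ.++⁺ ps-as (pe ∷ ps-bs)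

<-rightEnd : ∀ {k ℓ u} → length ℓ ≡ suc k → PosRadii ℓ → u < rightEnd u ℓ
<-rightEnd {ℓ = ℓ} len 0<rs = <-by-gap _ (<-≤-trans (rad-pos len 0<rs) (≤-by-gap (rad ℓ) (rad-nonneg (All.map <⇒≤ 0<rs)) refl)) refl

tiling : ∀ k ℓ → length ℓ ≡ k → PosRadii ℓ → ∀ {u} → CoversOC ℓ u (rightEnd u ℓ) →
  moment ℓ ≡ rad ℓ * (u + rad ℓ) × All (Within u (rightEnd u ℓ)) ℓ
tiling zero    []      _  _ {u} _ = sym (*-zeroˡ (u + 0ℚ)) , []
tiling (suc k) ℓ len 0<rs {u} cov
  with as , bs , (c , r) , refl , u∈e ← pick (closure ℓ (<-rightEnd len 0<rs) cov) =
  moment-eq , all-insert as {c , r} bs e-within (All.map rest-within (proj₂ ih))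
  where
  rest : List Interval
  rest = as ++ bs
  0<r : 0ℚ < r
  0<r = proj₁ (all-remove as bs 0<rs)
  0<rest : PosRadii rest
  0<rest = proj₂ (all-remove as bs 0<rs)
  len' : length rest ≡ k
  len' = length-remove as (c , r) bs len
  tile : c ≡ u + r × CoversOC rest (u + (r + r)) (rightEnd (u + (r + r)) rest)
  tile = first-tile k as (c , r) bs len' (All.map <⇒≤ 0<rest) cov u∈e
  ih : moment rest ≡ rad rest * ((u + (r + r)) + rad rest) × All (Within (u + (r + r)) (rightEnd (u + (r + r)) rest)) rest
  ih = tiling k rest len' 0<rest (proj₂ tile)
  end-of-rest : rightEnd (u + (r + r)) rest ≡ rightEnd u (as ++ (c , r) ∷ bs)
  end-of-rest = trans (sym (rightEnd-shift u rest (r + r))) (sym (rightEnd-remove u as (c , r) bs))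
  e-within : Within u (rightEnd u (as ++ (c , r) ∷ bs)) (c , r)
  e-within = within (≤-reflexive (sym left-end))
                    (subst₂ _≤_ right-end end-of-rest (≤-rightEnd (All.map <⇒≤ 0<rest)))
    where
    left-end : c - r ≡ u
    left-end = trans (cong (_- r) (proj₁ tile)) (plus-minus u r)
    right-end : u + (r + r) ≡ c + r
    right-end = trans (sym (+-assoc u r r)) (cong (_+ r) (sym (proj₁ tile)))
  rest-within : ∀ {e} → Within (u + (r + r)) (rightEnd (u + (r + r)) rest) e →
                Within u (rightEnd u (as ++ (c , r) ∷ bs)) e
  rest-within (within l≥ h≤) =
    within (≤-trans (≤-by-gap _ (0≤+ (<⇒≤ 0<r) (<⇒≤ 0<r)) refl) l≥) (subst (_ ≤_) end-of-rest h≤)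
  moment-eq : moment (as ++ (c , r) ∷ bs) ≡ rad (as ++ (c , r) ∷ bs) * (u + rad (as ++ (c , r) ∷ bs))
  moment-eq = begin
    moment (as ++ (c , r) ∷ bs)                  ≡⟨ ∑-remove _ as (c , r) bs ⟩
    r * c + moment rest                          ≡⟨ cong₂ (λ c' m → r * c' + m) (proj₁ tile) (proj₁ ih) ⟩
    r * (u + r) + rad rest * ((u + (r + r)) + rad rest) ≡⟨ tiles-add u r (rad rest) ⟩
    (r + rad rest) * (u + (r + rad rest))        ≡⟨ sym (cong (λ H → H * (u + H)) (∑-remove radius as (c , r) bs)) ⟩
    rad (as ++ (c , r) ∷ bs) * (u + rad (as ++ (c , r) ∷ bs)) ∎
    where
    open ≡-Reasoning
    tiles-add : ∀ u r H → r * (u + r) + H * ((u + (r + r)) + H) ≡ (r + H) * (u + (r + H))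
    tiles-add = solve-∀ ℚ-ring

toℚ : ℕ → ℚ
toℚ zero    = 0ℚ
toℚ (suc n) = 1ℚ + toℚ n

toℚ-nonneg : ∀ n → 0ℚ ≤ toℚ n
toℚ-nonneg zero    = ≤-refl
toℚ-nonneg (suc n) = 0≤+ 0≤1 (toℚ-nonneg n)

toℚ-mono : ∀ {m n} → m ℕ.≤ n → toℚ m ≤ toℚ n
toℚ-mono {n = n} ℕ.z≤n = toℚ-nonneg n
toℚ-mono (ℕ.s≤s m≤n)   = +-monoʳ-≤ 1ℚ (toℚ-mono m≤n)

toℚᵘ-toℚ : ∀ n → toℚᵘ (toℚ n) ≃ᵘ mkℚᵘ (ℤ.+ n) 0
toℚᵘ-toℚ zero    = ℚᵘ.≃-refl
toℚᵘ-toℚ (suc n) = ℚᵘ.≃-trans (toℚᵘ-homo-+ 1ℚ (toℚ n))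
  (ℚᵘ.≃-trans (ℚᵘ.+-congʳ (toℚᵘ 1ℚ) (toℚᵘ-toℚ n)) (*≡* (cong (λ z → (ℤ.+ 1 ℤ.+ z) ℤ.* ℤ.+ 1) (ℤ.*-identityʳ (ℤ.+ n)))))

archimedean : ∀ q → ∃[ N ] (q < toℚ N)
archimedean (mkℚ n d _) = suc ℤ.∣ n ∣ ,
  toℚᵘ-cancel-< (ℚᵘ.<-respʳ-≃ (ℚᵘ.≃-sym (toℚᵘ-toℚ (suc ℤ.∣ n ∣))) (*<* n<∣n∣+1))
  where
  n≤∣n∣ : ∀ n → n ℤ.≤ ℤ.+ ℤ.∣ n ∣
  n≤∣n∣ (ℤ.+ _)    = ℤ.≤-refl
  n≤∣n∣ ℤ.-[1+ _ ] = ℤ.-≤+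
  n<∣n∣+1 : n ℤ.* ℤ.+ 1 ℤ.< ℤ.+ suc ℤ.∣ n ∣ ℤ.* ℤ.+ suc d
  n<∣n∣+1 = ℤ.≤-<-trans (ℤ.≤-reflexive (ℤ.*-identityʳ n))
    (ℤ.≤-<-trans (n≤∣n∣ n) (ℤ.<-≤-trans (ℤ.+<+ ℕ.≤-refl) (ℤ.+≤+ (ℕ.m≤m*n (suc ℤ.∣ n ∣) (suc d)))))

sumFin-cong : ∀ n {f g : Fin n → ℚ} → (∀ i → f i ≡ g i) → sumFin n f ≡ sumFin n g
sumFin-cong zero    f≡g = refl
sumFin-cong (suc n) f≡g = cong₂ _+_ (f≡g zero) (sumFin-cong n (λ i → f≡g (suc i)))

sumFin-const : ∀ n d → sumFin n (λ _ → d) ≡ toℚ n * d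
sumFin-const zero    d = sym (*-zeroˡ d)
sumFin-const (suc n) d = trans (cong (d +_) (sumFin-const n d)) (distrib d (toℚ n))
  where
  distrib : ∀ d n → d + n * d ≡ (1ℚ + n) * d
  distrib = solve-∀ ℚ-ring

p≤∣p∣ : ∀ p → p ≤ ∣ p ∣
p≤∣p∣ p with ∣p∣≡p∨∣p∣≡-p p
... | inj₁ ∣p∣≡p  = ≤-reflexive (sym ∣p∣≡p)
... | inj₂ ∣p∣≡-p = ≤-trans p≤0 (0≤∣p∣ p)
  where
  p≤0 : p ≤ 0ℚ
  p≤0 = subst₂ _≤_ (+-identityʳ p) (+-inverseʳ p) (+-monoʳ-≤ p (subst (0ℚ ≤_) ∣p∣≡-p (0≤∣p∣ p)))

displacement≤movement : ∀ n (f g : Fin n → ℚ) →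
  sumFin n f - sumFin n g ≤ sumFin n (λ i → ∣ f i - g i ∣)
displacement≤movement zero    f g = ≤-reflexive (+-inverseʳ 0ℚ)
displacement≤movement (suc n) f g = begin
  (f zero + F) - (g zero + G)  ≡⟨ regroup (f zero) F (g zero) G ⟩
  (f zero - g zero) + (F - G)  ≤⟨ +-mono-≤ (p≤∣p∣ (f zero - g zero)) (displacement≤movement n (f ∘ suc) (g ∘ suc)) ⟩
  ∣ f zero - g zero ∣ + sumFin n (λ i → ∣ f (suc i) - g (suc i) ∣) ∎
  where
  open ≤-Reasoning
  F G : ℚ
  F = sumFin n (f ∘ suc)
  G = sumFin n (g ∘ suc)
  regroup : ∀ a F b G → (a + F) - (b + G) ≡ (a - b) + (F - G)
  regroup = solve-∀ ℚ-ring

∑-tabulate : ∀ n h (g : Fin n → Interval) → ∑ h (tabulate g) ≡ sumFin n (h ∘ g)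
∑-tabulate zero    h g = refl
∑-tabulate (suc n) h g = cong (h (g zero) +_) (∑-tabulate n h (g ∘ suc))

units : (n : ℕ) → ℚ → Fin n → ℚ
units (suc n) u zero    = u + 1ℚ
units (suc n) u (suc j) = units n (u + (1ℚ + 1ℚ)) j

units-sum : ∀ n u → sumFin n (units n u) ≡ toℚ n * u + toℚ n * toℚ n
units-sum zero    u = sym (trans (cong (_+ 0ℚ) (*-zeroˡ u)) (+-identityʳ 0ℚ))
units-sum (suc n) u = trans (cong ((u + 1ℚ) +_) (units-sum n (u + (1ℚ + 1ℚ)))) (step u (toℚ n))
  where
  step : ∀ u n → (u + 1ℚ) + (n * (u + (1ℚ + 1ℚ)) + n * n) ≡ (1ℚ + n) * u + (1ℚ + n) * (1ℚ + n)
  step = solve-∀ ℚ-ring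

units-shift : ∀ n u d j → units n (u + d) j ≡ units n u j + d
units-shift (suc n) u d zero    = +-right-comm u d 1ℚ
units-shift (suc n) u d (suc j) =
  trans (cong (λ v → units n v j) (+-right-comm u d (1ℚ + 1ℚ))) (units-shift n (u + (1ℚ + 1ℚ)) d j)

units-lower : ∀ n u j → u + 1ℚ ≤ units n u j
units-lower (suc n) u zero    = ≤-refl
units-lower (suc n) u (suc j) =
  ≤-trans (+-monoˡ-≤ 1ℚ (≤-by-gap {u} (1ℚ + 1ℚ) (0≤+ 0≤1 0≤1) refl)) (units-lower n (u + (1ℚ + 1ℚ)) j)

units-increasing : ∀ n u {i j : Fin n} → i Fin.< j → units n u i < units n u j
units-increasing (suc n) u {zero}  {suc j} _ =
  <-≤-trans (+-monoˡ-< 1ℚ (<-by-gap {u} (1ℚ + 1ℚ) 0<2 refl)) (units-lower n (u + (1ℚ + 1ℚ)) j)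
  where
  0<2 : 0ℚ < 1ℚ + 1ℚ
  0<2 = <-≤-trans (positive⁻¹ 1ℚ) (≤-by-gap {1ℚ} 1ℚ 0≤1 refl)
units-increasing (suc n) u {suc i} {suc j} (ℕ.s≤s i<j) = units-increasing n (u + (1ℚ + 1ℚ)) i<j

units-cover : ∀ n u p → u ≤ p → p ≤ u + (toℚ (suc n) + toℚ (suc n)) →
  ∃[ j ] (p ∈ᵢ (units (suc n) u j , 1ℚ))
units-cover n u p u≤p p≤end with p ≤? u + (1ℚ + 1ℚ)
... | yes p≤u+2 = zero , subst (_≤ p) (sym (plus-minus u 1ℚ)) u≤p , subst (p ≤_) (sym (+-assoc u 1ℚ 1ℚ)) p≤u+2
units-cover zero    u p u≤p p≤end | no p≰u+2 =
  ⊥-elim (p≰u+2 (subst (p ≤_) (cong (λ x → u + (x + x)) (+-identityʳ 1ℚ)) p≤end))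
units-cover (suc n) u p u≤p p≤end | no p≰u+2 =
  let j , p∈j = units-cover n (u + (1ℚ + 1ℚ)) p (<⇒≤ (≰⇒> p≰u+2))
                  (≤-trans p≤end (≤-reflexive (units-end-shift u (toℚ (suc n)))))
  in suc j , p∈j
  where
  units-end-shift : ∀ u m → u + ((1ℚ + m) + (1ℚ + m)) ≡ (u + (1ℚ + 1ℚ)) + (m + m)
  units-end-shift = solve-∀ ℚ-ring

maxFin-const : ∀ k c → maxFin k (λ _ → c) ≡ c
maxFin-const zero    c = refl
maxFin-const (suc k) c = trans (cong (c ⊔_) (maxFin-const k c)) (⊔-idem c)

minFin-const : ∀ k c → minFin k (λ _ → c) ≡ c
minFin-const zero    c = refl
minFin-const (suc k) c = trans (cong (c ⊓_) (minFin-const k c)) (⊓-idem c)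

attained : ∀ I (P : Pos I → Set) c → (∀ y → P y → c ≤ cost I y) →
  ∀ y → P y → cost I y ≡ c → IsMinCost I P c
attained I P c lower y Py cost≡c = lower , λ ε 0<ε → y , Py , <-by-gap ε 0<ε (cong (_+ ε) cost≡c)

module BarrierFamily (ρ : ℚ) (1≤ρ : 1ℚ ≤ ρ) where

  0<ρ : 0ℚ < ρ
  0<ρ = <-≤-trans (positive⁻¹ 1ℚ) 1≤ρ

  H : ℕ → ℚ
  H n = ρ + toℚ n

  xs rs : (n : ℕ) → Fin (suc n) → ℚ
  xs n zero    = - ρ
  xs n (suc j) = units n 0ℚ j
  rs n zero    = ρ
  rs n (suc j) = 1ℚ

  xs-sorted : ∀ n (i j : Fin (suc n)) → i Fin.< j → xs n i ≤ xs n j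
  xs-sorted n zero    (suc j) _            = ≤-trans (≤-trans -ρ≤0 (≤-by-gap 1ℚ 0≤1 refl)) (units-lower n 0ℚ j)
    where
    -ρ≤0 : - ρ ≤ 0ℚ
    -ρ≤0 = ≤-trans (≤-reflexive (sym (+-identityˡ (- ρ)))) (≤-trans (+-monoˡ-≤ (- ρ) (<⇒≤ 0<ρ)) (≤-reflexive (+-inverseʳ ρ)))
  xs-sorted n (suc i) (suc j) (ℕ.s≤s i<j) = <⇒≤ (units-increasing n 0ℚ i<j)

  rs-pos : ∀ n (i : Fin (suc n)) → 0ℚ < rs n i
  rs-pos n zero    = 0<ρ
  rs-pos n (suc j) = positive⁻¹ 1ℚ

  barrier : ℕ → Instance
  barrier n = record { m = n ; x = xs n ; r = rs n ; L = H n + H n ; x-sorted = xs-sorted n ; r-pos = rs-pos n }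

  0≤2H : ∀ n → 0ℚ ≤ H n + H n
  0≤2H n = 0≤+ (0≤+ (<⇒≤ 0<ρ) (toℚ-nonneg n)) (0≤+ (<⇒≤ 0<ρ) (toℚ-nonneg n))

  opt optop : ℕ → ℚ
  opt n   = H n + H n
  optop n = (ρ + ρ) * (1ℚ + toℚ n)

  sensor : ∀ n → Pos (barrier n) → Fin (suc n) → Interval
  sensor n y i = y i , rs n i

  sensors : ∀ n → Pos (barrier n) → List Interval
  sensors n y = tabulate (sensor n y)

  rad-sensors : ∀ n y → rad (sensors n y) ≡ H n
  rad-sensors n y = trans (∑-tabulate (suc n) radius (sensor n y))
    (cong (ρ +_) (trans (sumFin-const n 1ℚ) (*-identityʳ (toℚ n))))

  moment-sensors : ∀ n y → moment (sensors n y) ≡ ρ * y zero + sumFin n (y ∘ suc)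
  moment-sensors n y = trans (∑-tabulate (suc n) (λ e → radius e * centre e) (sensor n y))
    (cong (ρ * y zero +_) (sumFin-cong n (λ j → *-identityˡ (y (suc j)))))

  sensors-end : ∀ n y → rightEnd 0ℚ (sensors n y) ≡ H n + H n
  sensors-end n y = trans (+-identityˡ _) (cong (λ h → h + h) (rad-sensors n y))

  solution-covers : ∀ n y → IsSolution (barrier n) y → CoversOC (sensors n y) 0ℚ (rightEnd 0ℚ (sensors n y))
  solution-covers n y sol p 0<p p≤end with i , p∈i ← sol p (<⇒≤ 0<p) (≤-trans p≤end (≤-reflexive (sensors-end n y))) =
    Anyₚ.tabulate⁺ {f = sensor n y} i p∈i

  solution-tiles : ∀ n y → IsSolution (barrier n) y →
    ρ * y zero + sumFin n (y ∘ suc) ≡ H n * H n × Within 0ℚ (H n + H n) (y zero , ρ)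
  solution-tiles n y sol = moment-eq , first-within
    where
    tiles : moment (sensors n y) ≡ rad (sensors n y) * (0ℚ + rad (sensors n y)) ×
            All (Within 0ℚ (rightEnd 0ℚ (sensors n y))) (sensors n y)
    tiles = tiling (suc n) (sensors n y) (length-tabulate (sensor n y))
              (Allₚ.tabulate⁺ {f = sensor n y} (rs-pos n)) (solution-covers n y sol)
    moment-eq : ρ * y zero + sumFin n (y ∘ suc) ≡ H n * H n
    moment-eq = begin
      ρ * y zero + sumFin n (y ∘ suc)                  ≡⟨ sym (moment-sensors n y) ⟩
      moment (sensors n y)                            ≡⟨ proj₁ tiles ⟩
      rad (sensors n y) * (0ℚ + rad (sensors n y))    ≡⟨ cong (λ h → h * (0ℚ + h)) (rad-sensors n y) ⟩
      H n * (0ℚ + H n)                                ≡⟨ cong (H n *_) (+-identityˡ (H n)) ⟩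
      H n * H n                                       ∎
      where open ≡-Reasoning
    first-within : Within 0ℚ (H n + H n) (y zero , ρ)
    first-within with within l≥0 h≤end ← Allₚ.tabulate⁻ {f = sensor n y} (proj₂ tiles) zero =
      within l≥0 (≤-trans h≤end (≤-reflexive (sensors-end n y)))

  displacement : ∀ n y → IsSolution (barrier n) y →
    sumFin (suc n) y - sumFin (suc n) (xs n) ≡ opt n + (ρ - 1ℚ) * ((ρ + (toℚ n + toℚ n)) - y zero)
  displacement n y sol = begin
    (y zero + S) - (- ρ + sumFin n (units n 0ℚ))
      ≡⟨ cong₂ (λ s t → (y zero + s) - (- ρ + t)) S≡ (units-sum n 0ℚ) ⟩
    (y zero + (H n * H n - ρ * y zero)) - (- ρ + (toℚ n * 0ℚ + toℚ n * toℚ n))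
      ≡⟨ expand ρ (toℚ n) (y zero) ⟩
    opt n + (ρ - 1ℚ) * ((ρ + (toℚ n + toℚ n)) - y zero) ∎
    where
    open ≡-Reasoning
    S : ℚ
    S = sumFin n (y ∘ suc)
    S≡ : S ≡ H n * H n - ρ * y zero
    S≡ = trans (sym (plus-minus-left (ρ * y zero) S)) (cong (_- ρ * y zero) (proj₁ (solution-tiles n y sol)))
    expand : ∀ ρ n y₀ → (y₀ + ((ρ + n) * (ρ + n) - ρ * y₀)) - (- ρ + (n * 0ℚ + n * n))
                      ≡ ((ρ + n) + (ρ + n)) + (ρ - 1ℚ) * ((ρ + (n + n)) - y₀)
    expand = solve-∀ ℚ-ring

  -- Lower bound for arbitrary solutions: sensor 0 ends inside the barrier, so y₀ ≤ ρ + 2n.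
  opt-lower : ∀ n y → IsSolution (barrier n) y → opt n ≤ cost (barrier n) y
  opt-lower n y sol = begin
    opt n                                                 ≤⟨ ≤-by-gap _ (0≤* (0≤-diff 1≤ρ) room) refl ⟩
    opt n + (ρ - 1ℚ) * ((ρ + (toℚ n + toℚ n)) - y zero)    ≡⟨ sym (displacement n y sol) ⟩
    sumFin (suc n) y - sumFin (suc n) (xs n)               ≤⟨ displacement≤movement (suc n) y (xs n) ⟩
    cost (barrier n) y                                     ∎
    where
    open ≤-Reasoning
    room : 0ℚ ≤ (ρ + (toℚ n + toℚ n)) - y zero
    room = ≤-trans (0≤-diff (Within.right-end (proj₂ (solution-tiles n y sol))))
                   (≤-reflexive (slack ρ (toℚ n) (y zero)))
      where
      slack : ∀ ρ n y₀ → ((ρ + n) + (ρ + n)) - (y₀ + ρ) ≡ (ρ + (n + n)) - y₀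
      slack = solve-∀ ℚ-ring

  -- The unit sensors alone have total length 2n < 2H, so by packing they cannot cover the barrier.
  units-cannot-cover : ∀ n (y : Pos (barrier n)) → ¬ CoversOC (tabulate (sensor n y ∘ suc)) 0ℚ (H n + H n)
  units-cannot-cover n y cov = <⇒≱ 2n<2H (≤-trans (packing n unit-sensors (length-tabulate (sensor n y ∘ suc))
    (Allₚ.tabulate⁺ {f = sensor n y ∘ suc} (λ _ → 0≤1)) cov) (≤-reflexive end≡2n))
    where
    unit-sensors : List Interval
    unit-sensors = tabulate (sensor n y ∘ suc)
    end≡2n : rightEnd 0ℚ unit-sensors ≡ toℚ n + toℚ n
    end≡2n = trans (+-identityˡ _) (cong (λ h → h + h)
      (trans (∑-tabulate n radius (sensor n y ∘ suc)) (trans (sumFin-const n 1ℚ) (*-identityʳ (toℚ n)))))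
    2n<2H : toℚ n + toℚ n < H n + H n
    2n<2H = <-by-gap (ρ + ρ) (<-≤-trans 0<ρ (≤-by-gap ρ (<⇒≤ 0<ρ) refl)) (regroup ρ (toℚ n))
      where
      regroup : ∀ ρ n → (n + n) + (ρ + ρ) ≡ (ρ + n) + (ρ + n)
      regroup = solve-∀ ℚ-ring

  -- In an order-preserving solution, sensor 0 is active and covers the origin: y₀ ≤ ρ.
  -- Otherwise either the units alone cover the barrier, or a unit left of sensor 0 covers 0.
  order-preserving⇒y₀≤ρ : ∀ n y → OrderPreserving (barrier n) y → y zero ≤ ρ
  order-preserving⇒y₀≤ρ n y (S , active , increasing) with active 0ℚ ≤-refl (0≤2H n)
  ... | zero  , _   , (l≤0 , _) = diff≤0⇒≤ l≤0
  ... | suc j , j∈S , (l≤0 , _) with zero ∈? S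
  ...   | yes 0∈S = <⇒≤ (<-≤-trans (increasing zero (suc j) 0∈S j∈S (ℕ.s≤s ℕ.z≤n)) (≤-trans (diff≤0⇒≤ l≤0) 1≤ρ))
  ...   | no  0∉S = ⊥-elim (units-cannot-cover n y units-alone-cover)
    where
    units-alone-cover : CoversOC (tabulate (sensor n y ∘ suc)) 0ℚ (H n + H n)
    units-alone-cover p 0<p p≤L with active p (<⇒≤ 0<p) p≤L
    ... | zero   , 0∈S , _    = ⊥-elim (0∉S 0∈S)
    ... | suc j' , _   , p∈j' = Anyₚ.tabulate⁺ {f = sensor n y ∘ suc} j' p∈j'

  -- Lower bound for order-preserving solutions: there y₀ = ρ exactly.
  optop-lower : ∀ n y → IsSolution (barrier n) y → OrderPreserving (barrier n) y → optop n ≤ cost (barrier n) y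
  optop-lower n y sol op = begin
    optop n                                                ≡⟨ optop-as-displacement ρ (toℚ n) ⟩
    opt n + (ρ - 1ℚ) * ((ρ + (toℚ n + toℚ n)) - ρ)          ≡⟨ cong (λ y₀ → opt n + (ρ - 1ℚ) * ((ρ + (toℚ n + toℚ n)) - y₀)) (sym y₀≡ρ) ⟩
    opt n + (ρ - 1ℚ) * ((ρ + (toℚ n + toℚ n)) - y zero)     ≡⟨ sym (displacement n y sol) ⟩
    sumFin (suc n) y - sumFin (suc n) (xs n)                ≤⟨ displacement≤movement (suc n) y (xs n) ⟩
    cost (barrier n) y                                      ∎
    where
    open ≤-Reasoning
    y₀≡ρ : y zero ≡ ρ
    y₀≡ρ = ≤-antisym (order-preserving⇒y₀≤ρ n y op) (0≤diff⇒≤ (Within.left-end (proj₂ (solution-tiles n y sol))))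
    optop-as-displacement : ∀ ρ n → (ρ + ρ) * (1ℚ + n) ≡ ((ρ + n) + (ρ + n)) + (ρ - 1ℚ) * ((ρ + (n + n)) - ρ)
    optop-as-displacement = solve-∀ ℚ-ring

  -- Optimal solution: the units stay, sensor 0 moves right to cover [2n , 2H].
  y-opt : ∀ n → Pos (barrier n)
  y-opt n zero    = ρ + (toℚ n + toℚ n)
  y-opt n (suc j) = units n 0ℚ j

  y-opt-solution : ∀ k → IsSolution (barrier (suc k)) (y-opt (suc k))
  y-opt-solution k p 0≤p p≤L with toℚ (suc k) + toℚ (suc k) ≤? p
  ... | yes 2n≤p = zero , ≤-trans (≤-reflexive (plus-minus-left ρ _)) 2n≤p
                        , ≤-trans p≤L (≤-reflexive (regroup ρ (toℚ (suc k))))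
    where
    regroup : ∀ ρ n → (ρ + n) + (ρ + n) ≡ (ρ + (n + n)) + ρ
    regroup = solve-∀ ℚ-ring
  ... | no  2n≰p = let j , p∈j = units-cover k 0ℚ p 0≤p (≤-trans (<⇒≤ (≰⇒> 2n≰p)) (≤-reflexive (sym (+-identityˡ _))))
                   in suc j , p∈j

  y-opt-cost : ∀ n → cost (barrier n) (y-opt n) ≡ opt n
  y-opt-cost n = begin
    ∣ (ρ + (toℚ n + toℚ n)) - (- ρ) ∣ + sumFin n (λ j → ∣ units n 0ℚ j - units n 0ℚ j ∣)
      ≡⟨ cong₂ _+_ (cong ∣_∣ (regroup ρ (toℚ n))) (sumFin-cong n (λ j → cong ∣_∣ (+-inverseʳ (units n 0ℚ j)))) ⟩
    ∣ opt n ∣ + sumFin n (λ _ → 0ℚ)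
      ≡⟨ cong₂ _+_ (0≤p⇒∣p∣≡p (0≤2H n)) (trans (sumFin-const n 0ℚ) (*-zeroʳ (toℚ n))) ⟩
    opt n + 0ℚ
      ≡⟨ +-identityʳ (opt n) ⟩
    opt n ∎
    where
    open ≡-Reasoning
    regroup : ∀ ρ n → (ρ + (n + n)) - (- ρ) ≡ (ρ + n) + (ρ + n)
    regroup = solve-∀ ℚ-ring

  -- Optimal order-preserving solution: sensor 0 covers [0 , 2ρ], every unit moves right by 2ρ.
  y-op : ∀ n → Pos (barrier n)
  y-op n zero    = ρ
  y-op n (suc j) = units n (ρ + ρ) j

  y-op-solution : ∀ k → IsSolution (barrier (suc k)) (y-op (suc k))
  y-op-solution k p 0≤p p≤L with p ≤? ρ + ρ
  ... | yes p≤2ρ = zero , ≤-trans (≤-reflexive (+-inverseʳ ρ)) 0≤p , p≤2ρ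
  ... | no  p≰2ρ = let j , p∈j = units-cover k (ρ + ρ) p (<⇒≤ (≰⇒> p≰2ρ)) (≤-trans p≤L (≤-reflexive (regroup ρ (toℚ (suc k)))))
                   in suc j , p∈j
    where
    regroup : ∀ ρ n → (ρ + n) + (ρ + n) ≡ (ρ + ρ) + (n + n)
    regroup = solve-∀ ℚ-ring

  y-op-increasing : ∀ n (i j : Fin (suc n)) → i Fin.< j → y-op n i < y-op n j
  y-op-increasing n zero    (suc j) _           = <-≤-trans ρ<2ρ+1 (units-lower n (ρ + ρ) j)
    where
    ρ<2ρ+1 : ρ < (ρ + ρ) + 1ℚ
    ρ<2ρ+1 = <-by-gap (ρ + 1ℚ) (<-≤-trans 0<ρ (≤-by-gap 1ℚ 0≤1 refl)) (sym (+-assoc ρ ρ 1ℚ))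
  y-op-increasing n (suc i) (suc j) (ℕ.s≤s i<j) = units-increasing n (ρ + ρ) i<j

  y-op-order-preserving : ∀ k → OrderPreserving (barrier (suc k)) (y-op (suc k))
  y-op-order-preserving k =
    ⊤ , (λ p 0≤p p≤L → let i , p∈i = y-op-solution k p 0≤p p≤L in i , ∈⊤ , p∈i) ,
    (λ i j _ _ → y-op-increasing (suc k) i j)

  y-op-cost : ∀ n → cost (barrier n) (y-op n) ≡ optop n
  y-op-cost n = begin
    ∣ ρ - (- ρ) ∣ + sumFin n (λ j → ∣ units n (ρ + ρ) j - units n 0ℚ j ∣)
      ≡⟨ cong₂ _+_ (trans (cong ∣_∣ (double ρ)) (0≤p⇒∣p∣≡p 0≤2ρ)) (sumFin-cong n shifted-by-2ρ) ⟩
    (ρ + ρ) + sumFin n (λ _ → ρ + ρ)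
      ≡⟨ cong ((ρ + ρ) +_) (sumFin-const n (ρ + ρ)) ⟩
    (ρ + ρ) + toℚ n * (ρ + ρ)
      ≡⟨ factor (ρ + ρ) (toℚ n) ⟩
    optop n ∎
    where
    open ≡-Reasoning
    0≤2ρ : 0ℚ ≤ ρ + ρ
    0≤2ρ = 0≤+ (<⇒≤ 0<ρ) (<⇒≤ 0<ρ)
    double : ∀ ρ → ρ - (- ρ) ≡ ρ + ρ
    double = solve-∀ ℚ-ring
    factor : ∀ d n → d + n * d ≡ d * (1ℚ + n)
    factor = solve-∀ ℚ-ring
    shifted-by-2ρ : ∀ j → ∣ units n (ρ + ρ) j - units n 0ℚ j ∣ ≡ ρ + ρ
    shifted-by-2ρ j = begin
      ∣ units n (ρ + ρ) j - units n 0ℚ j ∣             ≡⟨ cong (λ u → ∣ units n u j - units n 0ℚ j ∣) (sym (+-identityˡ (ρ + ρ))) ⟩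
      ∣ units n (0ℚ + (ρ + ρ)) j - units n 0ℚ j ∣      ≡⟨ cong (λ u → ∣ u - units n 0ℚ j ∣) (units-shift n 0ℚ (ρ + ρ) j) ⟩
      ∣ (units n 0ℚ j + (ρ + ρ)) - units n 0ℚ j ∣      ≡⟨ cong ∣_∣ (plus-minus-left (units n 0ℚ j) (ρ + ρ)) ⟩
      ∣ ρ + ρ ∣                                       ≡⟨ 0≤p⇒∣p∣≡p 0≤2ρ ⟩
      ρ + ρ                                           ∎

  has-ratio : ∀ k → HasRatio (barrier (suc k)) ρ
  has-ratio k = begin
    ρ ⊔ maxFin k (λ _ → 1ℚ)   ≡⟨ cong (ρ ⊔_) (maxFin-const k 1ℚ) ⟩
    ρ ⊔ 1ℚ                    ≡⟨ p≥q⇒p⊔q≡p 1≤ρ ⟩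
    ρ                         ≡⟨ sym (*-identityʳ ρ) ⟩
    ρ * 1ℚ                    ≡⟨ cong (ρ *_) (sym (p≥q⇒p⊓q≡q 1≤ρ)) ⟩
    ρ * (ρ ⊓ 1ℚ)              ≡⟨ cong (λ m → ρ * (ρ ⊓ m)) (sym (minFin-const k 1ℚ)) ⟩
    ρ * (ρ ⊓ minFin k (λ _ → 1ℚ)) ∎
    where open ≡-Reasoning

  opt-pos : ∀ n → 0ℚ < opt n
  opt-pos n = <-≤-trans 0<ρ (≤-by-gap _ (0≤+ (toℚ-nonneg n) (0≤+ (<⇒≤ 0<ρ) (toℚ-nonneg n))) (sym (+-assoc ρ (toℚ n) _)))

  C : ℚ
  C = (ρ + ρ) * (ρ - 1ℚ)

  gap : ∀ n → ∣ optop n - ρ * opt n ∣ ≡ C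
  gap n = begin
    ∣ optop n - ρ * opt n ∣  ≡⟨ cong ∣_∣ (difference ρ (toℚ n)) ⟩
    ∣ - C ∣                  ≡⟨ ∣-p∣≡∣p∣ C ⟩
    ∣ C ∣                    ≡⟨ 0≤p⇒∣p∣≡p (0≤* (0≤+ (<⇒≤ 0<ρ) (<⇒≤ 0<ρ)) (0≤-diff 1≤ρ)) ⟩
    C                        ∎
    where
    open ≡-Reasoning
    difference : ∀ ρ n → (ρ + ρ) * (1ℚ + n) - ρ * ((ρ + n) + (ρ + n)) ≡ - ((ρ + ρ) * (ρ - 1ℚ))
    difference = solve-∀ ℚ-ring

  -- Since opt grows without bound, the relative gap tends to 0.
  relative-gap : ∀ ε → 0ℚ < ε → Σ ℕ λ N → ∀ k → k ≥ℕ N →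
    ∣ optop (suc k) - ρ * opt (suc k) ∣ < ε * opt (suc k)
  relative-gap ε 0<ε = N , λ k k≥N → begin-strict
    ∣ optop (suc k) - ρ * opt (suc k) ∣  ≡⟨ gap (suc k) ⟩
    C                                    ≡⟨ C≡C/ε*ε ⟩
    C * 1/ε * ε                          <⟨ *-monoˡ-<-pos ε {{positive 0<ε}} C/ε<N ⟩
    toℚ N * ε                            ≤⟨ *-monoʳ-≤-nonNeg ε {{nonNegative (<⇒≤ 0<ε)}} (N≤opt k k≥N) ⟩
    opt (suc k) * ε                      ≡⟨ *-comm (opt (suc k)) ε ⟩
    ε * opt (suc k)                      ∎
    where
    open ≤-Reasoning
    instance
      ε≢0 : NonZero ε
      ε≢0 = pos⇒nonZero ε {{positive 0<ε}}
    1/ε : ℚ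
    1/ε = 1/ ε
    N : ℕ
    N = proj₁ (archimedean (C * 1/ε))
    C/ε<N : C * 1/ε < toℚ N
    C/ε<N = proj₂ (archimedean (C * 1/ε))
    C≡C/ε*ε : C ≡ C * 1/ε * ε
    C≡C/ε*ε = sym (trans (*-assoc C 1/ε ε) (trans (cong (C *_) (*-inverseˡ ε)) (*-identityʳ C)))
    N≤opt : ∀ k → k ≥ℕ N → toℚ N ≤ opt (suc k)
    N≤opt k k≥N = ≤-trans (toℚ-mono (ℕ.m≤n⇒m≤1+n k≥N))
      (≤-by-gap _ (0≤+ (<⇒≤ 0<ρ) (0≤+ (<⇒≤ 0<ρ) (toℚ-nonneg (suc k)))) (regroup ρ (toℚ (suc k))))
      where
      regroup : ∀ ρ n → n + (ρ + (ρ + n)) ≡ (ρ + n) + (ρ + n)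
      regroup = solve-∀ ℚ-ring

lemma4 : ∀ (ρ : ℚ) → 1ℚ ≤ ρ →
    Σ (ℕ → Instance) λ I → Σ (ℕ → ℚ) λ opt → Σ (ℕ → ℚ) λ optop →
      ((∀ (k : ℕ) → HasRatio (I k) ρ × OPT (I k) (opt k) × OPTop (I k) (optop k) × 0ℚ < opt k) ×
       (∀ (ε : ℚ) → 0ℚ < ε → Σ ℕ λ N → (∀ (k : ℕ) → k ≥ℕ N →
          ∣ optop k - ρ * opt k ∣ < ε * opt k)))
lemma4 ρ 1≤ρ =
  barrier ∘ suc , opt ∘ suc , optop ∘ suc ,
  (λ k → has-ratio k , opt-correct k , optop-correct k , opt-pos (suc k)) ,
  relative-gap
  where
  open BarrierFamily ρ 1≤ρ
  opt-correct : ∀ k → OPT (barrier (suc k)) (opt (suc k))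
  opt-correct k = attained (barrier (suc k)) (IsSolution (barrier (suc k))) (opt (suc k))
    (opt-lower (suc k)) (y-opt (suc k)) (y-opt-solution k) (y-opt-cost (suc k))
  optop-correct : ∀ k → OPTop (barrier (suc k)) (optop (suc k))
  optop-correct k =
    attained (barrier (suc k)) (λ y → IsSolution (barrier (suc k)) y × OrderPreserving (barrier (suc k)) y)
      (optop (suc k)) (λ y (sol , op) → optop-lower (suc k) y sol op)
    (y-op (suc k)) (y-op-solution k , y-op-order-preserving k) (y-op-cost (suc k))
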